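{- Fix $r\ge 3$, $n$ divisible by $r$, $V=[n]$, $\mathcal K=\binom{V}{r}$, integers $\delta_x$ ($x\in V$), and an integer $m_T\le|\mathcal K|$; set $T=|\mathcal K|-m_T$, and for $0\le t\le T$ let $m_t=|\mathcal K|-t$ and $\mathcal K^t=\binom{\mathcal K}{m_t}$. Let $\mathcal L=\{\mathcal J\subseteq\mathcal K: d_{\mathcal J}(x)\ge\delta_x\ \forall x\in V\}$ and $\mathcal L_T=\mathcal L\cap\mathcal K^T$, assumed nonempty. Choose $\mathbf H_T$ uniformly from $\mathcal L_T$, let $A_1,\dots,A_T$ be a uniformly random ordering of $\mathcal K\setminus\mathbf H_T$, and set $\mathbf H_t=\mathcal K\setminus\{A_1,\dots,A_t\}$. For $\mathcal H\subseteq\mathcal K$ with $|\mathcal H|\ge m_T$ let $\beta(\mathcal H)=\mathbb P(\mathbf U_{\mathcal H}\in\mathcal L)$ with $\mathbf U_{\mathcal H}$ a uniformly random $m_T$-subset of $\mathcal H$. Then for $t\in[T]$ and $\mathcal H\in\mathcal K^{t-1}$ (with $\mathbb P(\mathbf H_{t-1}=\mathcal H)>0$), among $A\in\mathcal H$, \[ \mathbb P(A_t=A\mid \mathbf H_{t-1}=\mathcal H)\ \propto\ \beta(\mathcal H\setminus\{A\}). \]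
   Context: $d_{\mathcal J}(x)$ denotes the number of members of $\mathcal J$ containing $x$. "$\propto$" means proportional with constant independent of $A$. -}

module Defs where

open import Data.Bool using (Bool; true; false; _∧_; not; if_then_else_)
open import Data.Nat as ℕ using (ℕ; zero; suc; _∸_; _≡ᵇ_)
open import Data.Integer as ℤ using (ℤ; +_)
open import Data.Rational as ℚ using (ℚ; 0ℚ; _/_)
open import Data.Fin using (Fin; toℕ)
open import Data.Fin.Subset using (Subset; inside; outside; ∣_∣)
open import Data.Vec as Vec using (Vec; []; _∷_; lookup; tabulate)
open import Data.List as List using (List; []; _∷_; _++_; filter; map; concatMap; length; foldr; take)
open import Data.Bool.ListAction using (any; all)
open import Data.Fin.Subset.Properties using (_⊆?_)
open import Data.Product using (_×_; _,_; proj₁; proj₂)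
open import Relation.Nullary using (yes; no; does)
open import Relation.Binary.PropositionalEquality using (_≡_)

Dist : Set → Set
Dist A = List (A × ℚ)

uniform : {A : Set} → List A → Dist A
uniform [] = []
uniform xs@(_ ∷ _) = map (λ a → a , (+ 1) / length xs) xs

bind : {A B : Set} → Dist A → (A → Dist B) → Dist B
bind d f = concatMap (λ ap → map (λ bq → proj₁ bq , proj₂ ap ℚ.* proj₂ bq) (f (proj₁ ap))) d

Pr : {A : Set} → Dist A → (A → Bool) → ℚ
Pr d E = foldr (λ ap s → (if E (proj₁ ap) then proj₂ ap else 0ℚ) ℚ.+ s) 0ℚ d

-- conditional probability P(E | F) = P(E ∧ F) / P(F)  (0 if P(F) = 0)
CondPr : {A : Set} → Dist A → (A → Bool) → (A → Bool) → ℚ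
CondPr d E F with Pr d F ℚ.≟ 0ℚ
... | yes _ = 0ℚ
... | no ¬0 = Pr d (λ a → E a ∧ F a) ℚ.÷ Pr d F
  where instance _ = ℚ.≢-nonZero ¬0

allSubsets : (k : ℕ) → List (Subset k)
allSubsets zero = [] ∷ []
allSubsets (suc k) = map (inside ∷_) (allSubsets k) ++ map (outside ∷_) (allSubsets k)

allFinL : (k : ℕ) → List (Fin k)
allFinL k = Vec.toList (Vec.allFin k)

allVecs : (N k : ℕ) → List (Vec (Fin N) k)
allVecs N zero = [] ∷ []
allVecs N (suc k) = concatMap (λ i → map (i ∷_) (allVecs N k)) (allFinL N)

finEq : {k : ℕ} → Fin k → Fin k → Bool
finEq i j = toℕ i ≡ᵇ toℕ j

subsetEq : {k : ℕ} → Subset k → Subset k → Bool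
subsetEq [] [] = true
subsetEq (a ∷ s) (b ∷ t) = (if a then b else not b) ∧ subsetEq s t

-- The setting: V = Fin n, 𝒦 = (V choose r), indexed by Fin N with N = |𝒦|.

module Setup (n r : ℕ) (δ : Fin n → ℤ) (mT : ℕ) where

  𝒦 : List (Subset n)
  𝒦 = filter (λ s → ∣ s ∣ ℕ.≟ r) (allSubsets n)

  N : ℕ
  N = length 𝒦

  edge : Fin N → Subset n
  edge = List.lookup 𝒦

  T : ℕ
  T = N ∸ mT

  -- sub-families 𝒥 ⊆ 𝒦 are subsets of the index set Fin N.
  -- degree d_𝒥(x) = number of members of 𝒥 containing x
  deg : Subset N → Fin n → ℕ
  deg J x = ∣ tabulate (λ i → lookup J i ∧ lookup (edge i) x) ∣

  inL : Subset N → Bool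
  inL J = all (λ x → does (δ x ℤ.≤? + deg J x)) (allFinL n)

  LT : List (Subset N)
  LT = List.filterᵇ (λ J → (∣ J ∣ ≡ᵇ mT) ∧ inL J) (allSubsets N)

  occ : {k : ℕ} → Fin N → Vec (Fin N) k → ℕ
  occ i [] = 0
  occ i (j ∷ σ) = (if finEq i j then 1 else 0) ℕ.+ occ i σ

  isOrderingOfCompl : Subset N → Vec (Fin N) T → Bool
  isOrderingOfCompl J σ =
    all (λ i → occ i σ ≡ᵇ (if lookup J i then 0 else 1)) (allFinL N)

  orderings : Subset N → List (Vec (Fin N) T)
  orderings J = List.filterᵇ (isOrderingOfCompl J) (allVecs N T)

  Ω : Dist (Subset N × Vec (Fin N) T)
  Ω = bind (uniform LT) (λ H → map (λ sq → (H , proj₁ sq) , proj₂ sq) (uniform (orderings H)))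

  -- A_{k+1} (k : Fin T, i.e. t = k+1 ∈ [T])
  A-at : Fin T → Subset N × Vec (Fin N) T → Fin N
  A-at k ω = lookup (proj₂ ω) k

  H-at : ℕ → Subset N × Vec (Fin N) T → Subset N
  H-at t ω = tabulate (λ i → not (any (finEq i) (take t (Vec.toList (proj₂ ω)))))

  mTsubsets : Subset N → List (Subset N)
  mTsubsets H = List.filterᵇ (λ U → (∣ U ∣ ≡ᵇ mT) ∧ does (U ⊆? H)) (allSubsets N)

  β : Subset N → ℚ
  β H = Pr (uniform (mTsubsets H)) inL

module Submission where

-- Write ω = (J, σ): J is the uniform member of ℒ_T and σ a uniform
-- ordering of 𝒦 ∖ J.  For fixed J with |J| = m_T, the orderings σ with
-- A_{k+1} = A and 𝐇_k = H are exactly the words that list 𝒦 ∖ J, whose first k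
-- letters form 𝒦 ∖ H and whose letter at position k is A.  Such words exist only
-- if J ⊆ H - A, and then their number depends on the sizes |J|, k, T alone.
-- Summing over J, P(A_{k+1} = A, 𝐇_k = H) is a constant times the number of
-- members of ℒ of size m_T inside H - A, while β(H - A) is that number divided
-- by the binomial coefficient (|H| - 1 choose m_T), again independent of A.

open import Defs
open import Data.Bool using (Bool; true; false; _∧_; _∨_; not; if_then_else_)
open import Data.Bool.Properties
  using (∧-identityʳ; ∧-zeroʳ; ∧-comm; ∧-conicalˡ; ∧-conicalʳ; T-≡; ¬-not; not-involutive)
open import Data.Bool.ListAction using (any; all)
open import Data.Nat using (ℕ; zero; suc; pred; _≤_; _∸_; _≡ᵇ_; z≤n; s≤s)
import Data.Nat.Properties as ℕₚ
open import Data.Nat.Combinatorics using (_C_; nCk+nC[k+1]≡[n+1]C[k+1])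
open import Data.Nat.ListAction using (sum)
open import Data.Nat.Divisibility using (_∣_)
open import Data.Integer using (ℤ)
open import Data.Rational using (ℚ; 0ℚ)
open import Data.Fin using (Fin; toℕ; zero; suc)
open import Data.Fin.Properties using (toℕ-injective; toℕ<n)
open import Data.Fin.Subset using (Subset; inside; outside; ∣_∣; _∈_; _-_; ∁)
open import Data.Fin.Subset.Properties using (_⊆?_; p─⊥≡p; ∣∁p∣≡n∸∣p∣)
open import Data.Vec using (Vec; []; _∷_; lookup; tabulate; toList)
import Data.Vec.Properties as Vecₚ
open import Data.List using (List; []; _∷_; _++_; map; concatMap; length; filterᵇ; take)
open import Data.Product using (∃; _×_; _,_; proj₁; proj₂)
open import Data.Product.Function.NonDependent.Propositional using (_×-⇔_)
open import Function using (_∘_; _⇔_; mk⇔; Equivalence)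
open import Function.Properties.Equivalence using () renaming (trans to ⇔-trans)
open import Relation.Nullary using (yes; no; does; contradiction)
open import Relation.Binary.PropositionalEquality
open Equivalence using (to; from)

module Finite where
  open import Data.Nat using (_+_; _*_)

  _Decides_ : {A : Set} → (A → Bool) → (A → Set) → Set
  P Decides R = ∀ x → P x ≡ true ⇔ R x

  Π-⇔ : {I : Set} {P Q : I → Set} → (∀ i → P i ⇔ Q i) → (∀ i → P i) ⇔ (∀ i → Q i)
  Π-⇔ h = mk⇔ (λ p i → to (h i) (p i)) (λ q i → from (h i) (q i))

  ≡-respects-⇔ : {A : Set} {a a′ b b′ : A} → a ≡ a′ → b ≡ b′ → (a ≡ b) ⇔ (a′ ≡ b′)
  ≡-respects-⇔ refl refl = mk⇔ (λ e → e) (λ e → e)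

  ∧⇔ : {a b : Bool} → a ∧ b ≡ true ⇔ (a ≡ true × b ≡ true)
  ∧⇔ {a} {b} = mk⇔ (λ e → ∧-conicalˡ a b e , ∧-conicalʳ a b e) (λ (e₁ , e₂) → cong₂ _∧_ e₁ e₂)

  not-≡⇔ : {a b : Bool} → not a ≡ b ⇔ a ≡ not b
  not-≡⇔ {a} {b} = mk⇔ (λ e → trans (sym (not-involutive a)) (cong not e))
                       (λ e → trans (cong not e) (not-involutive b))

  ∧-swapʳ : ∀ a b c → (a ∧ b) ∧ c ≡ (a ∧ c) ∧ b
  ∧-swapʳ true  b c = ∧-comm b c
  ∧-swapʳ false b c = refl

  ≡ᵇ⇔ : {m c : ℕ} → (m ≡ᵇ c) ≡ true ⇔ m ≡ c
  ≡ᵇ⇔ {m} {c} = mk⇔ (λ e → ℕₚ.≡ᵇ⇒≡ m c (from T-≡ e)) (λ e → to T-≡ (ℕₚ.≡⇒≡ᵇ m c e))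

  finEq-refl : {n : ℕ} (i : Fin n) → finEq i i ≡ true
  finEq-refl i = from (≡ᵇ⇔ {toℕ i} {toℕ i}) refl

  finEq-sound : {n : ℕ} (i j : Fin n) → finEq i j ≡ true → i ≡ j
  finEq-sound i j e = toℕ-injective (to (≡ᵇ⇔ {toℕ i} {toℕ j}) e)

  finEq⇔ : {n : ℕ} {i j : Fin n} → finEq i j ≡ true ⇔ i ≡ j
  finEq⇔ {i = i} {j} = mk⇔ (finEq-sound i j) (λ { refl → finEq-refl i })

  finEq-≢ : {n : ℕ} {i j : Fin n} → i ≢ j → finEq i j ≡ false
  finEq-≢ i≢j = ¬-not (λ e → i≢j (finEq-sound _ _ e))

  ind : Bool → ℕ
  ind true  = 1
  ind false = 0

  ind≡0 : {b : Bool} → ind b ≡ 0 → b ≡ false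
  ind≡0 {false} _ = refl
  ind≡0 {true}  ()

  ind≡suc : {b : Bool} {m : ℕ} → ind b ≡ suc m → b ≡ true
  ind≡suc {true} _ = refl

  countB : {A : Set} → (A → Bool) → List A → ℕ
  countB p []       = 0
  countB p (x ∷ xs) = ind (p x) + countB p xs

  countB-cong : {A : Set} {p q : A → Bool} (xs : List A) → (∀ x → p x ≡ q x) → countB p xs ≡ countB q xs
  countB-cong []       e = refl
  countB-cong (x ∷ xs) e = cong₂ _+_ (cong ind (e x)) (countB-cong xs e)

  countB-none : {A : Set} (p : A → Bool) (xs : List A) → (∀ x → p x ≢ true) → countB p xs ≡ 0
  countB-none p []       h = refl
  countB-none p (x ∷ xs) h with p x in e
  ... | true  = contradiction e (h x)
  ... | false = countB-none p xs h

  countB≤length : {A : Set} (p : A → Bool) (xs : List A) → countB p xs ≤ length xs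
  countB≤length p []       = z≤n
  countB≤length p (x ∷ xs) with p x
  ... | true  = s≤s (countB≤length p xs)
  ... | false = ℕₚ.m≤n⇒m≤1+n (countB≤length p xs)

  length-filterᵇ : {A : Set} (q : A → Bool) (xs : List A) → length (filterᵇ q xs) ≡ countB q xs
  length-filterᵇ q []       = refl
  length-filterᵇ q (x ∷ xs) with q x
  ... | true  = cong suc (length-filterᵇ q xs)
  ... | false = length-filterᵇ q xs

  countB-filterᵇ : {A : Set} (p q : A → Bool) (xs : List A) →
    countB p (filterᵇ q xs) ≡ countB (λ x → q x ∧ p x) xs
  countB-filterᵇ p q []       = refl
  countB-filterᵇ p q (x ∷ xs) with q x
  ... | true  = cong (ind (p x) +_) (countB-filterᵇ p q xs)
  ... | false = countB-filterᵇ p q xs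

  countB-++ : {A : Set} (p : A → Bool) (xs ys : List A) → countB p (xs ++ ys) ≡ countB p xs + countB p ys
  countB-++ p []       ys = refl
  countB-++ p (x ∷ xs) ys = trans (cong (ind (p x) +_) (countB-++ p xs ys)) (sym (ℕₚ.+-assoc (ind (p x)) _ _))

  countB-map : {A B : Set} (p : B → Bool) (f : A → B) (xs : List A) → countB p (map f xs) ≡ countB (p ∘ f) xs
  countB-map p f []       = refl
  countB-map p f (x ∷ xs) = cong (ind (p (f x)) +_) (countB-map p f xs)

  countB-concatMap : {A B : Set} (p : B → Bool) (f : A → List B) (xs : List A) →
    countB p (concatMap f xs) ≡ sum (map (countB p ∘ f) xs)
  countB-concatMap p f []       = refl
  countB-concatMap p f (x ∷ xs) = trans (countB-++ p (f x) (concatMap f xs)) (cong (countB p (f x) +_) (countB-concatMap p f xs))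

  sumFin : (n : ℕ) → (Fin n → ℕ) → ℕ
  sumFin zero    f = 0
  sumFin (suc n) f = f zero + sumFin n (f ∘ suc)

  sumFin-cong : (n : ℕ) {f g : Fin n → ℕ} → (∀ i → f i ≡ g i) → sumFin n f ≡ sumFin n g
  sumFin-cong zero    e = refl
  sumFin-cong (suc n) e = cong₂ _+_ (e zero) (sumFin-cong n (e ∘ suc))

  sumFin-zero : (n : ℕ) → sumFin n (λ _ → 0) ≡ 0
  sumFin-zero zero    = refl
  sumFin-zero (suc n) = sumFin-zero n

  sum-tabulate : (n : ℕ) {A : Set} (h : A → ℕ) (g : Fin n → A) → sum (map h (toList (tabulate g))) ≡ sumFin n (h ∘ g)
  sum-tabulate zero    h g = refl
  sum-tabulate (suc n) h g = cong (h (g zero) +_) (sum-tabulate n h (g ∘ suc))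

  sumFin-subset : {n : ℕ} (S : Subset n) (v : ℕ) → sumFin n (λ i → ind (lookup S i) * v) ≡ ∣ S ∣ * v
  sumFin-subset []          v = refl
  sumFin-subset (true ∷ S)  v = cong₂ _+_ (ℕₚ.+-identityʳ v) (sumFin-subset S v)
  sumFin-subset (false ∷ S) v = sumFin-subset S v

  sumFin-single : {n : ℕ} (a : Fin n) (v : ℕ) → sumFin n (λ i → ind (finEq i a) * v) ≡ v
  sumFin-single {suc n} zero    v = trans (cong₂ _+_ (ℕₚ.+-identityʳ v) (sumFin-zero n)) (ℕₚ.+-identityʳ v)
  sumFin-single {suc n} (suc a) v = sumFin-single a v

  all-tabulate : (n : ℕ) {A : Set} (p : A → Bool) (g : Fin n → A) →
    all p (toList (tabulate g)) ≡ true ⇔ (∀ i → p (g i) ≡ true)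
  all-tabulate zero    p g = mk⇔ (λ _ ()) (λ _ → refl)
  all-tabulate (suc n) p g = mk⇔
    (λ h → λ { zero → ∧-conicalˡ _ _ h ; (suc i) → to (all-tabulate n p (g ∘ suc)) (∧-conicalʳ _ _ h) i })
    (λ h → cong₂ _∧_ (h zero) (from (all-tabulate n p (g ∘ suc)) (h ∘ suc)))

  lookup-minus : {n : ℕ} (p : Subset n) (a i : Fin n) → lookup (p - a) i ≡ lookup p i ∧ not (finEq i a)
  lookup-minus (x ∷ p) zero    zero    = sym (∧-zeroʳ x)
  lookup-minus (x ∷ p) zero    (suc i) = trans (cong (λ q → lookup q i) (p─⊥≡p p)) (sym (∧-identityʳ _))
  lookup-minus (x ∷ p) (suc a) zero    = sym (∧-identityʳ x)
  lookup-minus (x ∷ p) (suc a) (suc i) = lookup-minus p a i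

  lookup-minus-self : {n : ℕ} (p : Subset n) (a : Fin n) → lookup (p - a) a ≡ false
  lookup-minus-self p a = trans (lookup-minus p a a) (trans (cong (λ b → lookup p a ∧ not b) (finEq-refl a)) (∧-zeroʳ _))

  size-minus : {n : ℕ} (p : Subset n) (a : Fin n) → lookup p a ≡ true → suc ∣ p - a ∣ ≡ ∣ p ∣
  size-minus (true  ∷ p) zero    _ = cong (suc ∘ ∣_∣) (p─⊥≡p p)
  size-minus (false ∷ p) zero    ()
  size-minus (true  ∷ p) (suc a) e = cong suc (size-minus p a e)
  size-minus (false ∷ p) (suc a) e = size-minus p a e

  size-removal : {n : ℕ} (p : Subset n) (a : Fin n) → lookup p a ≡ true → ∣ p - a ∣ ≡ pred ∣ p ∣
  size-removal p a e = cong pred (size-minus p a e)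

  size≡0⇒empty : {n : ℕ} (S : Subset n) → ∣ S ∣ ≡ 0 → ∀ i → lookup S i ≡ false
  size≡0⇒empty (false ∷ S) e zero    = refl
  size≡0⇒empty (false ∷ S) e (suc i) = size≡0⇒empty S e i
  size≡0⇒empty (true  ∷ S) () i

  empty⇒size≡0 : {n : ℕ} (S : Subset n) → (∀ i → lookup S i ≡ false) → ∣ S ∣ ≡ 0
  empty⇒size≡0 []          h = refl
  empty⇒size≡0 (true  ∷ S) h = contradiction (h zero) λ ()
  empty⇒size≡0 (false ∷ S) h = empty⇒size≡0 S (h ∘ suc)

  ∁-antitone : {n : ℕ} (p q : Subset n) → (∀ i → lookup p i ≡ true → lookup q i ≡ true) →
    ∀ i → lookup (∁ q) i ≡ true → lookup (∁ p) i ≡ true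
  ∁-antitone p q p⊆q i ∁qᵢ = trans (Vecₚ.lookup-map i not p) (cong not pᵢ≡false)
    where
    pᵢ≡false : lookup p i ≡ false
    pᵢ≡false = ¬-not (λ pᵢ → contradiction
      (trans (sym (cong not (p⊆q i pᵢ))) (trans (sym (Vecₚ.lookup-map i not q)) ∁qᵢ)) λ ())

  ⊆?-sound : {n : ℕ} (p q : Subset n) → does (p ⊆? q) ≡ true → ∀ i → lookup p i ≡ true → lookup q i ≡ true
  ⊆?-sound p q e i pᵢ with p ⊆? q
  ... | yes p⊆q = Vecₚ.[]=⇒lookup (p⊆q (Vecₚ.lookup⇒[]= i p pᵢ))
  ... | no  _   = contradiction e λ ()

  ⊆?-complete : {n : ℕ} (p q : Subset n) → (∀ i → lookup p i ≡ true → lookup q i ≡ true) → does (p ⊆? q) ≡ true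
  ⊆?-complete p q h with p ⊆? q
  ... | yes _   = refl
  ... | no  p⊈q = contradiction (λ {x} x∈p → Vecₚ.lookup⇒[]= x q (h x (Vecₚ.[]=⇒lookup x∈p))) p⊈q

  subsetEq-sound : {n : ℕ} (u v : Subset n) → subsetEq u v ≡ true → ∀ i → lookup u i ≡ lookup v i
  subsetEq-sound (true  ∷ u) (true  ∷ v) e zero    = refl
  subsetEq-sound (false ∷ u) (false ∷ v) e zero    = refl
  subsetEq-sound (true  ∷ u) (true  ∷ v) e (suc i) = subsetEq-sound u v e i
  subsetEq-sound (false ∷ u) (false ∷ v) e (suc i) = subsetEq-sound u v e i
  subsetEq-sound (true  ∷ u) (false ∷ v) () _
  subsetEq-sound (false ∷ u) (true  ∷ v) () _

  subsetEq-complete : {n : ℕ} (u v : Subset n) → (∀ i → lookup u i ≡ lookup v i) → subsetEq u v ≡ true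
  subsetEq-complete []      []      _ = refl
  subsetEq-complete (a ∷ u) (b ∷ v) h =
    cong₂ _∧_ (subst (λ b → (if a then b else not b) ≡ true) (h zero) (agree a)) (subsetEq-complete u v (h ∘ suc))
    where
    agree : ∀ a → (if a then a else not a) ≡ true
    agree true  = refl
    agree false = refl

  subsetEq⇔ : {n : ℕ} (u v : Subset n) → subsetEq u v ≡ true ⇔ (∀ i → lookup u i ≡ lookup v i)
  subsetEq⇔ u v = mk⇔ (subsetEq-sound u v) (subsetEq-complete u v)

  -- The m-element subsets of Y number (|Y| choose m) (Pascal's rule).
  subsetsOfSize : {n : ℕ} (Y : Subset n) (m : ℕ) →
    countB (λ U → (∣ U ∣ ≡ᵇ m) ∧ does (U ⊆? Y)) (allSubsets n) ≡ ∣ Y ∣ C m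
  subsetsOfSize []      zero    = refl
  subsetsOfSize []      (suc m) = refl
  subsetsOfSize {suc n} (y ∷ Y) m = begin
    countB P (map (inside ∷_) (allSubsets n) ++ map (outside ∷_) (allSubsets n))
      ≡⟨ countB-++ P (map (inside ∷_) (allSubsets n)) _ ⟩
    countB P (map (inside ∷_) (allSubsets n)) + countB P (map (outside ∷_) (allSubsets n))
      ≡⟨ cong₂ _+_ (countB-map P (inside ∷_) (allSubsets n)) (countB-map P (outside ∷_) (allSubsets n)) ⟩
    countB (P ∘ (inside ∷_)) (allSubsets n) + countB (λ U → (∣ U ∣ ≡ᵇ m) ∧ does (U ⊆? Y)) (allSubsets n)
      ≡⟨ cong (countB (P ∘ (inside ∷_)) (allSubsets n) +_) (subsetsOfSize Y m) ⟩
    countB (P ∘ (inside ∷_)) (allSubsets n) + ∣ Y ∣ C m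
      ≡⟨ pascal y m ⟩
    ∣ y ∷ Y ∣ C m ∎
    where
    open ≡-Reasoning
    P : Subset (suc n) → Bool
    P U = (∣ U ∣ ≡ᵇ m) ∧ does (U ⊆? (y ∷ Y))
    -- subsets through the new point: none if it lies outside Y, else the (m-1)-subsets of Y
    Through : Bool → ℕ → Subset n → Bool
    Through y m U = (suc ∣ U ∣ ≡ᵇ m) ∧ does ((inside ∷ U) ⊆? (y ∷ Y))
    pascal : ∀ y m → countB (Through y m) (allSubsets n) + ∣ Y ∣ C m ≡ ∣ y ∷ Y ∣ C m
    pascal false m       = cong (_+ ∣ Y ∣ C m) (countB-none (Through false m) (allSubsets n)
                             λ U e → contradiction (trans (sym (∧-zeroʳ _)) e) λ ())
    pascal true  zero    = cong (_+ ∣ Y ∣ C 0) (countB-none (Through true zero) (allSubsets n) λ U ())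
    pascal true  (suc m) = trans (cong (_+ ∣ Y ∣ C suc m) (subsetsOfSize Y m)) (nCk+nC[k+1]≡[n+1]C[k+1] ∣ Y ∣ m)

module Words where
  open import Data.Nat using (_+_; _*_)
  open Finite

  private variable
    N L : ℕ

  occurrences : Fin N → Vec (Fin N) L → ℕ
  occurrences i []      = 0
  occurrences i (j ∷ σ) = ind (finEq i j) + occurrences i σ

  Enumerates : Subset N → Vec (Fin N) L → Set
  Enumerates S σ = ∀ i → occurrences i σ ≡ ind (lookup S i)

  HasPrefixSet : Subset N → ℕ → Vec (Fin N) L → Set
  HasPrefixSet X t σ = ∀ i → any (finEq i) (take t (toList σ)) ≡ lookup X i

  Marked : Subset N → Subset N → Fin L → Fin N → Vec (Fin N) L → Set
  Marked S X k A σ = Enumerates S σ × lookup σ k ≡ A × HasPrefixSet X (toℕ k) σ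

  -- The number of words of length L enumerating an s-element set (s! if L = s, else 0).
  arrangements : ℕ → ℕ → ℕ
  arrangements s       (suc L) = s * arrangements (pred s) L
  arrangements zero    zero    = 1
  arrangements (suc s) zero    = 0

  -- The number of those words that are moreover marked by a given t-set and letter.
  markedArrangements : ℕ → ℕ → ℕ → ℕ
  markedArrangements s zero    L = arrangements (pred s) (pred L)
  markedArrangements s (suc t) L = suc t * markedArrangements (pred s) t (pred L)

  ind-split : (S : Subset N) (a i : Fin N) → lookup S a ≡ true →
    ind (finEq i a) + ind (lookup (S - a) i) ≡ ind (lookup S i)
  ind-split S a i Sa = trans (cong (λ x → ind (finEq i a) + ind x) (lookup-minus S a i))
    (split (lookup S i) (finEq i a) (λ e → subst (λ j → lookup S j ≡ true) (sym (finEq-sound i a e)) Sa))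
    where
    split : ∀ s b → (b ≡ true → s ≡ true) → ind b + ind (s ∧ not b) ≡ ind s
    split s false _ = cong ind (∧-identityʳ s)
    split s true  h rewrite h refl = refl

  enumerates-head : (S : Subset N) (a : Fin N) (σ : Vec (Fin N) L) → Enumerates S (a ∷ σ) → lookup S a ≡ true
  enumerates-head S a σ e = ind≡suc (trans (sym (e a)) (cong (λ b → ind b + occurrences a σ) (finEq-refl a)))

  enumerates-cons : (S : Subset N) (a : Fin N) (σ : Vec (Fin N) L) → lookup S a ≡ true →
    Enumerates S (a ∷ σ) ⇔ Enumerates (S - a) σ
  enumerates-cons S a σ Sa = mk⇔
    (λ e i → ℕₚ.+-cancelˡ-≡ (ind (finEq i a)) _ _ (trans (e i) (sym (ind-split S a i Sa))))
    (λ e i → trans (cong (ind (finEq i a) +_) (e i)) (ind-split S a i Sa))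

  absent-from-prefix : (a : Fin N) (σ : Vec (Fin N) L) (t : ℕ) → occurrences a σ ≡ 0 →
    any (finEq a) (take t (toList σ)) ≡ false
  absent-from-prefix a σ       zero    _ = refl
  absent-from-prefix a []      (suc t) _ = refl
  absent-from-prefix a (j ∷ σ) (suc t) e with finEq a j
  ... | true  = contradiction e λ ()
  ... | false = absent-from-prefix a σ t e

  occurs-at : (σ : Vec (Fin N) L) (k : Fin L) → occurrences (lookup σ k) σ ≢ 0
  occurs-at (a ∷ σ) zero    e = contradiction (trans (cong (λ b → ind b + occurrences a σ) (sym (finEq-refl a))) e) λ ()
  occurs-at (a ∷ σ) (suc k) e = occurs-at σ k (ℕₚ.m+n≡0⇒n≡0 (ind (finEq (lookup σ k) a)) e)

  prefix-head : (X : Subset N) (a : Fin N) (σ : Vec (Fin N) L) (t : ℕ) →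
    HasPrefixSet X (suc t) (a ∷ σ) → lookup X a ≡ true
  prefix-head X a σ t p = trans (sym (p a)) (cong (λ b → b ∨ any (finEq a) (take t (toList σ))) (finEq-refl a))

  prefix-cons : (X : Subset N) (a : Fin N) (σ : Vec (Fin N) L) (t : ℕ) →
    occurrences a σ ≡ 0 → lookup X a ≡ true →
    HasPrefixSet X (suc t) (a ∷ σ) ⇔ HasPrefixSet (X - a) t σ
  prefix-cons X a σ t absent Xa = mk⇔ forward backward
    where
    InPrefix : Fin _ → Bool
    InPrefix i = any (finEq i) (take t (toList σ))

    forward : HasPrefixSet X (suc t) (a ∷ σ) → HasPrefixSet (X - a) t σ
    forward p i = trans (entry i (p i)) (sym (lookup-minus X a i))
      where
      entry : ∀ i → finEq i a ∨ InPrefix i ≡ lookup X i → InPrefix i ≡ lookup X i ∧ not (finEq i a)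
      entry i pᵢ with finEq i a in e
      ... | false = trans pᵢ (sym (∧-identityʳ _))
      ... | true  = trans (subst (λ j → InPrefix j ≡ false) (sym (finEq-sound i a e)) (absent-from-prefix a σ t absent))
                          (sym (∧-zeroʳ _))

    backward : HasPrefixSet (X - a) t σ → HasPrefixSet X (suc t) (a ∷ σ)
    backward q i with finEq i a in e
    ... | true  = sym (subst (λ j → lookup X j ≡ true) (sym (finEq-sound i a e)) Xa)
    ... | false = trans (q i) (trans (lookup-minus X a i) (trans (cong (λ b → lookup X i ∧ not b) e) (∧-identityʳ _)))

  marked-cons : (S X : Subset N) (k : Fin L) (A a : Fin N) (σ : Vec (Fin N) L) →
    lookup S a ≡ true → lookup X a ≡ true →
    Marked S X (suc k) A (a ∷ σ) ⇔ Marked (S - a) (X - a) k A σ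
  marked-cons S X k A a σ Sa Xa = mk⇔
    (λ (e , l , p) → let e′ = to (enumerates-cons S a σ Sa) e in
                     e′ , l , to (prefix-cons X a σ (toℕ k) (absent e′) Xa) p)
    (λ (e′ , l , p′) → from (enumerates-cons S a σ Sa) e′ , l , from (prefix-cons X a σ (toℕ k) (absent e′) Xa) p′)
    where
    absent : Enumerates (S - a) σ → occurrences a σ ≡ 0
    absent e′ = trans (e′ a) (cong ind (lookup-minus-self S a))

  marked-outside : (S X : Subset N) (k : Fin L) (A i : Fin N) (σ : Vec (Fin N) L) →
    Marked S X k A σ → lookup S i ≡ false → lookup X i ≡ false × i ≢ A
  marked-outside S X k A i σ (e , l , p) Sᵢ =
    trans (sym (p i)) (absent-from-prefix i σ (toℕ k) absent) ,
    λ i≡A → occurs-at σ k (subst (λ j → occurrences j σ ≡ 0) (trans i≡A (sym l)) absent)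
    where
    absent : occurrences i σ ≡ 0
    absent = trans (e i) (cong ind Sᵢ)

  countB-allVecs-suc : (P : Vec (Fin N) (suc L) → Bool) →
    countB P (allVecs N (suc L)) ≡ sumFin N (λ a → countB (P ∘ (a ∷_)) (allVecs N L))
  countB-allVecs-suc {N} {L} P = begin
    countB P (concatMap (λ a → map (a ∷_) (allVecs N L)) (allFinL N))
      ≡⟨ countB-concatMap P _ (allFinL N) ⟩
    sum (map (λ a → countB P (map (a ∷_) (allVecs N L))) (allFinL N))
      ≡⟨ sum-tabulate N (λ a → countB P (map (a ∷_) (allVecs N L))) (λ i → i) ⟩
    sumFin N (λ a → countB P (map (a ∷_) (allVecs N L)))
      ≡⟨ sumFin-cong N (λ a → countB-map P (a ∷_) (allVecs N L)) ⟩
    sumFin N (λ a → countB (P ∘ (a ∷_)) (allVecs N L)) ∎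
    where open ≡-Reasoning

  countEnumerations : (S : Subset N) (P : Vec (Fin N) L → Bool) → P Decides Enumerates S →
    countB P (allVecs N L) ≡ arrangements ∣ S ∣ L
  countEnumerations {L = zero} S P dec with P [] in P[] | ∣ S ∣ in ∣S∣
  ... | true  | zero  = refl
  ... | false | suc _ = refl
  ... | true  | suc _ =
    contradiction (trans (sym ∣S∣) (empty⇒size≡0 S (λ i → ind≡0 (sym (to (dec []) P[] i))))) λ ()
  ... | false | zero  =
    contradiction (trans (sym (from (dec []) (λ i → sym (cong ind (size≡0⇒empty S ∣S∣ i))))) P[]) λ ()
  countEnumerations {N} {suc L} S P dec = begin
    countB P (allVecs N (suc L))                                     ≡⟨ countB-allVecs-suc P ⟩
    sumFin N (λ a → countB (P ∘ (a ∷_)) (allVecs N L))                ≡⟨ sumFin-cong N first ⟩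
    sumFin N (λ a → ind (lookup S a) * arrangements (pred ∣ S ∣) L)   ≡⟨ sumFin-subset S _ ⟩
    ∣ S ∣ * arrangements (pred ∣ S ∣) L                               ∎
    where
    open ≡-Reasoning
    -- the first letter a lies in S, and the rest enumerates S - a
    first : ∀ a → countB (P ∘ (a ∷_)) (allVecs N L) ≡ ind (lookup S a) * arrangements (pred ∣ S ∣) L
    first a with lookup S a in Sa
    ... | true  = trans (countEnumerations (S - a) (P ∘ (a ∷_)) (λ σ → ⇔-trans (dec (a ∷ σ)) (enumerates-cons S a σ Sa)))
                        (trans (cong (λ s → arrangements s L) (size-removal S a Sa)) (sym (ℕₚ.+-identityʳ _)))
    ... | false = countB-none (P ∘ (a ∷_)) (allVecs N L)
                    (λ σ p → contradiction (trans (sym (enumerates-head S a σ (to (dec (a ∷ σ)) p))) Sa) λ ())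

  countMarked : (k : Fin L) (S X : Subset N) (A : Fin N) (P : Vec (Fin N) L → Bool) →
    (∀ i → lookup X i ≡ true → lookup S i ≡ true) → lookup S A ≡ true → lookup X A ≡ false →
    ∣ X ∣ ≡ toℕ k → P Decides Marked S X k A →
    countB P (allVecs N L) ≡ markedArrangements ∣ S ∣ (toℕ k) L
  countMarked {L = suc L} {N} zero S X A P X⊆S SA XA ∣X∣ dec = begin
    countB P (allVecs N (suc L))                                      ≡⟨ countB-allVecs-suc P ⟩
    sumFin N (λ a → countB (P ∘ (a ∷_)) (allVecs N L))                 ≡⟨ sumFin-cong N first ⟩
    sumFin N (λ a → ind (finEq a A) * arrangements (pred ∣ S ∣) L)     ≡⟨ sumFin-single A _ ⟩
    arrangements (pred ∣ S ∣) L                                        ∎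
    where
    open ≡-Reasoning
    emptyPrefix : (σ : Vec (Fin N) (suc L)) → HasPrefixSet X 0 σ
    emptyPrefix σ i = sym (size≡0⇒empty X ∣X∣ i)
    -- the first letter is A and the prefix set is empty; the rest enumerates S - A
    first : ∀ a → countB (P ∘ (a ∷_)) (allVecs N L) ≡ ind (finEq a A) * arrangements (pred ∣ S ∣) L
    first a with finEq a A in aA
    ... | true = subst (λ b → countB (P ∘ (b ∷_)) (allVecs N L) ≡ ind true * arrangements (pred ∣ S ∣) L)
                       (sym (finEq-sound a A aA)) startingWithA
      where
      startingWithA : countB (P ∘ (A ∷_)) (allVecs N L) ≡ ind true * arrangements (pred ∣ S ∣) L
      startingWithA =
        trans (countEnumerations (S - A) (P ∘ (A ∷_))
                 (λ σ → ⇔-trans (dec (A ∷ σ)) (⇔-trans (mk⇔ proj₁ (λ e → e , refl , emptyPrefix (A ∷ σ)))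
                                                        (enumerates-cons S A σ SA))))
              (trans (cong (λ s → arrangements s L) (size-removal S A SA)) (sym (ℕₚ.+-identityʳ _)))
    ... | false = countB-none (P ∘ (a ∷_)) (allVecs N L) λ σ p →
      contradiction (trans (sym aA) (subst (λ b → finEq a b ≡ true) (proj₁ (proj₂ (to (dec (a ∷ σ)) p))) (finEq-refl a))) λ ()
  countMarked {L = suc L} {N} (suc k) S X A P X⊆S SA XA ∣X∣ dec = begin
    countB P (allVecs N (suc L))                                                     ≡⟨ countB-allVecs-suc P ⟩
    sumFin N (λ a → countB (P ∘ (a ∷_)) (allVecs N L))                                ≡⟨ sumFin-cong N first ⟩
    sumFin N (λ a → ind (lookup X a) * markedArrangements (pred ∣ S ∣) (toℕ k) L)    ≡⟨ sumFin-subset X _ ⟩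
    ∣ X ∣ * markedArrangements (pred ∣ S ∣) (toℕ k) L                                ≡⟨ cong (_* _) ∣X∣ ⟩
    suc (toℕ k) * markedArrangements (pred ∣ S ∣) (toℕ k) L                          ∎
    where
    open ≡-Reasoning
    -- the first letter a lies in X, and the rest is marked by (S - a, X - a, k, A)
    first : ∀ a → countB (P ∘ (a ∷_)) (allVecs N L) ≡ ind (lookup X a) * markedArrangements (pred ∣ S ∣) (toℕ k) L
    first a with lookup X a in Xa
    ... | false = countB-none (P ∘ (a ∷_)) (allVecs N L) λ σ p →
      contradiction (trans (sym (prefix-head X a σ (toℕ k) (proj₂ (proj₂ (to (dec (a ∷ σ)) p))))) Xa) λ ()
    ... | true  =
      trans (countMarked k (S - a) (X - a) A (P ∘ (a ∷_)) X⊆S′ SA′ XA′ ∣X′∣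
               (λ σ → ⇔-trans (dec (a ∷ σ)) (marked-cons S X k A a σ Sa Xa)))
            (trans (cong (λ s → markedArrangements s (toℕ k) L) (size-removal S a Sa)) (sym (ℕₚ.+-identityʳ _)))
      where
      Sa : lookup S a ≡ true
      Sa = X⊆S a Xa
      A≢a : finEq A a ≡ false
      A≢a = finEq-≢ λ A≡a → contradiction (trans (sym XA) (subst (λ j → lookup X j ≡ true) (sym A≡a) Xa)) λ ()
      X⊆S′ : ∀ i → lookup (X - a) i ≡ true → lookup (S - a) i ≡ true
      X⊆S′ i h = let h′ = trans (sym (lookup-minus X a i)) h in
        trans (lookup-minus S a i) (cong₂ _∧_ (X⊆S i (∧-conicalˡ _ _ h′)) (∧-conicalʳ _ _ h′))
      SA′ : lookup (S - a) A ≡ true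
      SA′ = trans (lookup-minus S a A) (cong₂ _∧_ SA (cong not A≢a))
      XA′ : lookup (X - a) A ≡ false
      XA′ = trans (lookup-minus X a A) (cong (_∧ _) XA)
      ∣X′∣ : ∣ X - a ∣ ≡ toℕ k
      ∣X′∣ = ℕₚ.suc-injective (trans (size-minus X a Xa) ∣X∣)

module Probability where
  import Data.Integer as ℤ
  open import Data.Integer.GCD using (gcd)
  open import Data.Rational using (1ℚ; _+_; _*_; _/_; 1/_; ↥_; _≟_; NonZero; ≢-nonZero)
  import Data.Rational.Properties as ℚₚ
  open Finite using (ind; countB)

  private variable
    A B : Set

  toℚ : ℕ → ℚ
  toℚ zero    = 0ℚ
  toℚ (suc m) = 1ℚ + toℚ m

  weight : ℕ → ℚ
  weight zero    = 0ℚ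
  weight (suc m) = ℤ.+ 1 / suc m

  weight≢0 : (m : ℕ) → weight (suc m) ≢ 0ℚ
  weight≢0 m w≡0 = contradiction
    (trans (sym (ℚₚ.↥-/ (ℤ.+ 1) (suc m))) (cong (λ q → ↥ q ℤ.* gcd (ℤ.+ 1) (ℤ.+ suc m)) w≡0)) λ ()

  sumQ : (A → ℚ) → List A → ℚ
  sumQ h []       = 0ℚ
  sumQ h (x ∷ xs) = h x + sumQ h xs

  sumQ-cong : {h g : A → ℚ} (xs : List A) → (∀ x → h x ≡ g x) → sumQ h xs ≡ sumQ g xs
  sumQ-cong []       e = refl
  sumQ-cong (x ∷ xs) e = cong₂ _+_ (e x) (sumQ-cong xs e)

  sumQ-map : (h : B → ℚ) (f : A → B) (xs : List A) → sumQ h (map f xs) ≡ sumQ (h ∘ f) xs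
  sumQ-map h f []       = refl
  sumQ-map h f (x ∷ xs) = cong (h (f x) +_) (sumQ-map h f xs)

  sumQ-scale : (c : ℚ) (h : A → ℚ) (xs : List A) → sumQ (λ x → c * h x) xs ≡ c * sumQ h xs
  sumQ-scale c h []       = sym (ℚₚ.*-zeroʳ c)
  sumQ-scale c h (x ∷ xs) = trans (cong (c * h x +_) (sumQ-scale c h xs)) (sym (ℚₚ.*-distribˡ-+ c (h x) _))

  sumQ-on-filter : {h g : A → ℚ} (q : A → Bool) (xs : List A) → (∀ x → q x ≡ true → h x ≡ g x) →
    sumQ h (filterᵇ q xs) ≡ sumQ g (filterᵇ q xs)
  sumQ-on-filter q []       e = refl
  sumQ-on-filter q (x ∷ xs) e with q x in qx
  ... | true  = cong₂ _+_ (e x qx) (sumQ-on-filter q xs e)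
  ... | false = sumQ-on-filter q xs e

  sumQ-indicator : (K : ℚ) (b : A → Bool) (xs : List A) →
    sumQ (λ x → if b x then K else 0ℚ) xs ≡ K * toℚ (countB b xs)
  sumQ-indicator K b []       = sym (ℚₚ.*-zeroʳ K)
  sumQ-indicator K b (x ∷ xs) with b x
  ... | true  = trans (cong₂ _+_ (sym (ℚₚ.*-identityʳ K)) (sumQ-indicator K b xs)) (sym (ℚₚ.*-distribˡ-+ K 1ℚ _))
  ... | false = trans (ℚₚ.+-identityˡ _) (sumQ-indicator K b xs)

  contribution : (A → Bool) → A × ℚ → ℚ
  contribution E ap = if E (proj₁ ap) then proj₂ ap else 0ℚ

  Pr-as-sum : (d : Dist A) (E : A → Bool) → Pr d E ≡ sumQ (contribution E) d
  Pr-as-sum []      E = refl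
  Pr-as-sum (x ∷ d) E = cong (contribution E x +_) (Pr-as-sum d E)

  Pr-++ : (d d′ : Dist A) (E : A → Bool) → Pr (d ++ d′) E ≡ Pr d E + Pr d′ E
  Pr-++ []      d′ E = sym (ℚₚ.+-identityˡ _)
  Pr-++ (x ∷ d) d′ E = trans (cong (contribution E x +_) (Pr-++ d d′ E))
                             (sym (ℚₚ.+-assoc (contribution E x) (Pr d E) (Pr d′ E)))

  Pr-scale : (p : ℚ) (d : Dist A) (E : A → Bool) → Pr (map (λ bq → proj₁ bq , p * proj₂ bq) d) E ≡ p * Pr d E
  Pr-scale p []      E = sym (ℚₚ.*-zeroʳ p)
  Pr-scale p (x ∷ d) E with E (proj₁ x)
  ... | true  = trans (cong (p * proj₂ x +_) (Pr-scale p d E)) (sym (ℚₚ.*-distribˡ-+ p _ _))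
  ... | false = trans (ℚₚ.+-identityˡ _) (trans (Pr-scale p d E) (cong (p *_) (sym (ℚₚ.+-identityˡ _))))

  Pr-bind : (d : Dist A) (f : A → Dist B) (E : B → Bool) →
    Pr (bind d f) E ≡ sumQ (λ ap → proj₂ ap * Pr (f (proj₁ ap)) E) d
  Pr-bind []      f E = refl
  Pr-bind (x ∷ d) f E = trans (Pr-++ (map (λ bq → proj₁ bq , proj₂ x * proj₂ bq) (f (proj₁ x))) _ E)
                              (cong₂ _+_ (Pr-scale (proj₂ x) (f (proj₁ x)) E) (Pr-bind d f E))

  uniform-as-map : (xs : List A) → uniform xs ≡ map (λ a → a , weight (length xs)) xs
  uniform-as-map []       = refl
  uniform-as-map (x ∷ xs) = refl

  Pr-uniform : (xs : List A) (E : A → Bool) → Pr (uniform xs) E ≡ weight (length xs) * toℚ (countB E xs)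
  Pr-uniform xs E = begin
    Pr (uniform xs) E                                     ≡⟨ cong (λ d → Pr d E) (uniform-as-map xs) ⟩
    Pr (map (λ a → a , w) xs) E                           ≡⟨ Pr-as-sum (map (λ a → a , w) xs) E ⟩
    sumQ (contribution E) (map (λ a → a , w) xs)          ≡⟨ sumQ-map (contribution E) (λ a → a , w) xs ⟩
    sumQ (λ a → if E a then w else 0ℚ) xs                 ≡⟨ sumQ-indicator w E xs ⟩
    w * toℚ (countB E xs)                                 ∎
    where
    open ≡-Reasoning
    w : ℚ
    w = weight (length xs)

  Pr-pair : (a : A) (d : Dist B) (E : A × B → Bool) →
    Pr (map (λ bq → (a , proj₁ bq) , proj₂ bq) d) E ≡ Pr d (λ b → E (a , b))
  Pr-pair a []      E = refl
  Pr-pair a (x ∷ d) E = cong (contribution (λ b → E (a , b)) x +_) (Pr-pair a d E)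

  Pr-twoStage : {A B : Set} (xs : List A) (f : A → List B) (E : A × B → Bool) →
    Pr (bind (uniform xs) (λ x → map (λ yq → (x , proj₁ yq) , proj₂ yq) (uniform (f x)))) E
      ≡ weight (length xs) * sumQ (λ x → weight (length (f x)) * toℚ (countB (λ y → E (x , y)) (f x))) xs
  Pr-twoStage {A} {B} xs f E = begin
    Pr (bind (uniform xs) g) E                                  ≡⟨ Pr-bind (uniform xs) g E ⟩
    sumQ (λ ap → proj₂ ap * Pr (g (proj₁ ap)) E) (uniform xs)
      ≡⟨ cong (sumQ (λ ap → proj₂ ap * Pr (g (proj₁ ap)) E)) (uniform-as-map xs) ⟩
    sumQ (λ ap → proj₂ ap * Pr (g (proj₁ ap)) E) (map (λ a → a , w) xs)
      ≡⟨ sumQ-map (λ ap → proj₂ ap * Pr (g (proj₁ ap)) E) (λ a → a , w) xs ⟩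
    sumQ (λ x → w * Pr (g x) E) xs                              ≡⟨ sumQ-scale w (λ x → Pr (g x) E) xs ⟩
    w * sumQ (λ x → Pr (g x) E) xs
      ≡⟨ cong (w *_) (sumQ-cong xs λ x → trans (Pr-pair x (uniform (f x)) E) (Pr-uniform (f x) (λ y → E (x , y)))) ⟩
    w * sumQ (λ x → weight (length (f x)) * toℚ (countB (λ y → E (x , y)) (f x))) xs ∎
    where
    open ≡-Reasoning
    w : ℚ
    w = weight (length xs)
    g : A → Dist (A × B)
    g x = map (λ yq → (x , proj₁ yq) , proj₂ yq) (uniform (f x))

  CondPr-unfold : (d : Dist A) (E F : A → Bool) (ne : Pr d F ≢ 0ℚ) →
    CondPr d E F ≡ Pr d (λ a → E a ∧ F a) * (1/ Pr d F) {{≢-nonZero ne}}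
  CondPr-unfold d E F ne with Pr d F ≟ 0ℚ
  ... | yes e = contradiction e ne
  ... | no  _ = refl

  proportional : (K : ℚ) (M : ℕ) → ∃ λ c → ∀ z → z ≤ M → K * toℚ z ≡ c * (weight M * toℚ z)
  proportional K zero    = 0ℚ , λ { zero z≤n → trans (ℚₚ.*-zeroʳ K) (sym (ℚₚ.*-zeroˡ (weight zero * toℚ zero))) }
  proportional K (suc m) = K * 1/ w , λ z _ → sym (begin
    (K * 1/ w) * (w * toℚ z) ≡⟨ ℚₚ.*-assoc K (1/ w) _ ⟩
    K * (1/ w * (w * toℚ z)) ≡⟨ cong (K *_) (sym (ℚₚ.*-assoc (1/ w) w (toℚ z))) ⟩
    K * ((1/ w * w) * toℚ z) ≡⟨ cong (λ x → K * (x * toℚ z)) (ℚₚ.*-inverseˡ w) ⟩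
    K * (1ℚ * toℚ z)         ≡⟨ cong (K *_) (ℚₚ.*-identityˡ (toℚ z)) ⟩
    K * toℚ z                ∎)
    where
    open ≡-Reasoning
    w : ℚ
    w = weight (suc m)
    instance
      w≢0 : NonZero w
      w≢0 = ≢-nonZero (weight≢0 m)

module Model (n r : ℕ) (δ : Fin n → ℤ) (mT : ℕ) where
  open Setup n r δ mT
  open Finite
  open Words
  open Probability
  open import Data.Rational using (_*_)
  import Data.Rational.Properties as ℚₚ

  occ≡occurrences : {L : ℕ} (i : Fin N) (σ : Vec (Fin N) L) → occ i σ ≡ occurrences i σ
  occ≡occurrences i []      = refl
  occ≡occurrences i (j ∷ σ) with finEq i j
  ... | true  = cong suc (occ≡occurrences i σ)
  ... | false = occ≡occurrences i σ

  complement-entry : (J : Subset N) (i : Fin N) → (if lookup J i then 0 else 1) ≡ ind (lookup (∁ J) i)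
  complement-entry J i = trans (ifNot (lookup J i)) (cong ind (sym (Vecₚ.lookup-map i not J)))
    where
    ifNot : ∀ b → (if b then 0 else 1) ≡ ind (not b)
    ifNot true  = refl
    ifNot false = refl

  complement-size : (J : Subset N) → ∣ J ∣ ≡ mT → ∣ ∁ J ∣ ≡ N ∸ mT
  complement-size J ∣J∣ = trans (∣∁p∣≡n∸∣p∣ J) (cong (N ∸_) ∣J∣)

  ordering⇔ : (J : Subset N) → isOrderingOfCompl J Decides Enumerates (∁ J)
  ordering⇔ J σ = ⇔-trans (all-tabulate N _ (λ i → i))
    (Π-⇔ λ i → ⇔-trans ≡ᵇ⇔ (≡-respects-⇔ (occ≡occurrences i σ) (complement-entry J i)))

  history⇔ : (H : Subset N) (t : ℕ) (ω : Subset N × Vec (Fin N) T) →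
    subsetEq (H-at t ω) H ≡ true ⇔ HasPrefixSet (∁ H) t (proj₂ ω)
  history⇔ H t ω = ⇔-trans (subsetEq⇔ (H-at t ω) H) (Π-⇔ λ i →
    ⇔-trans (≡-respects-⇔ (Vecₚ.lookup∘tabulate _ i) refl)
            (⇔-trans not-≡⇔ (≡-respects-⇔ refl (sym (Vecₚ.lookup-map i not H)))))

  Step : Fin T → Fin N → Subset N → Subset N × Vec (Fin N) T → Bool
  Step k A H ω = finEq (A-at k ω) A ∧ subsetEq (H-at (toℕ k) ω) H

  step⇔marked : (J H : Subset N) (k : Fin T) (A : Fin N) →
    (λ σ → isOrderingOfCompl J σ ∧ Step k A H (J , σ)) Decides Marked (∁ J) (∁ H) k A
  step⇔marked J H k A σ =
    ⇔-trans ∧⇔ (ordering⇔ J σ ×-⇔ ⇔-trans ∧⇔ (finEq⇔ ×-⇔ history⇔ H (toℕ k) (J , σ)))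

  orderings-length : (J : Subset N) → ∣ J ∣ ≡ mT → length (orderings J) ≡ arrangements (N ∸ mT) T
  orderings-length J ∣J∣ = begin
    length (orderings J)                         ≡⟨ length-filterᵇ (isOrderingOfCompl J) (allVecs N T) ⟩
    countB (isOrderingOfCompl J) (allVecs N T)   ≡⟨ countEnumerations (∁ J) (isOrderingOfCompl J) (ordering⇔ J) ⟩
    arrangements ∣ ∁ J ∣ T                       ≡⟨ cong (λ s → arrangements s T) (complement-size J ∣J∣) ⟩
    arrangements (N ∸ mT) T                      ∎
    where open ≡-Reasoning

  marked⇒inclusion : (J H : Subset N) (k : Fin T) (A : Fin N) (σ : Vec (Fin N) T) →
    Marked (∁ J) (∁ H) k A σ → ∀ i → lookup J i ≡ true → lookup (H - A) i ≡ true
  marked⇒inclusion J H k A σ m i Jᵢ = trans (lookup-minus H A i) (cong₂ _∧_ Hᵢ (cong not (finEq-≢ (proj₂ iOutside))))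
    where
    iOutside : lookup (∁ H) i ≡ false × i ≢ A
    iOutside = marked-outside (∁ J) (∁ H) k A i σ m (trans (Vecₚ.lookup-map i not J) (cong not Jᵢ))
    Hᵢ : lookup H i ≡ true
    Hᵢ = trans (sym (not-involutive _)) (cong not (trans (sym (Vecₚ.lookup-map i not H)) (proj₁ iOutside)))

  orderings-step : (J H : Subset N) (k : Fin T) (A : Fin N) →
    ∣ J ∣ ≡ mT → ∣ H ∣ ≡ N ∸ toℕ k → lookup H A ≡ true →
    countB (λ σ → Step k A H (J , σ)) (orderings J)
      ≡ (if does (J ⊆? (H - A)) then markedArrangements (N ∸ mT) (toℕ k) T else 0)
  orderings-step J H k A ∣J∣ ∣H∣ HA with does (J ⊆? (H - A)) in J⊆?
  ... | true  = begin
    countB (λ σ → Step k A H (J , σ)) (orderings J)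
      ≡⟨ countB-filterᵇ _ (isOrderingOfCompl J) (allVecs N T) ⟩
    countB (λ σ → isOrderingOfCompl J σ ∧ Step k A H (J , σ)) (allVecs N T)
      ≡⟨ countMarked k (∁ J) (∁ H) A _ ∁H⊆∁J A∈∁J A∉∁H ∣∁H∣ (step⇔marked J H k A) ⟩
    markedArrangements ∣ ∁ J ∣ (toℕ k) T
      ≡⟨ cong (λ s → markedArrangements s (toℕ k) T) (complement-size J ∣J∣) ⟩
    markedArrangements (N ∸ mT) (toℕ k) T ∎
    where
    open ≡-Reasoning
    J⊆H-A : ∀ i → lookup J i ≡ true → lookup (H - A) i ≡ true
    J⊆H-A = ⊆?-sound J (H - A) J⊆?
    ∁H⊆∁J : ∀ i → lookup (∁ H) i ≡ true → lookup (∁ J) i ≡ true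
    ∁H⊆∁J = ∁-antitone J H λ i Jᵢ → ∧-conicalˡ _ _ (trans (sym (lookup-minus H A i)) (J⊆H-A i Jᵢ))
    A∈∁J : lookup (∁ J) A ≡ true
    A∈∁J = trans (Vecₚ.lookup-map A not J)
      (cong not (¬-not λ JA → contradiction (trans (sym (lookup-minus-self H A)) (J⊆H-A A JA)) λ ()))
    A∉∁H : lookup (∁ H) A ≡ false
    A∉∁H = trans (Vecₚ.lookup-map A not H) (cong not HA)
    ∣∁H∣ : ∣ ∁ H ∣ ≡ toℕ k
    ∣∁H∣ = trans (∣∁p∣≡n∸∣p∣ H) (trans (cong (N ∸_) ∣H∣)
             (ℕₚ.m∸[m∸n]≡n (ℕₚ.≤-trans (ℕₚ.<⇒≤ (toℕ<n k)) (ℕₚ.m∸n≤m N mT))))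
  ... | false = trans (countB-filterᵇ _ (isOrderingOfCompl J) (allVecs N T))
    (countB-none _ (allVecs N T) λ σ p →
      contradiction (trans (sym (⊆?-complete J (H - A) (marked⇒inclusion J H k A σ (to (step⇔marked J H k A σ) p))))
                           J⊆?) λ ())

  goodInside : Subset N → ℕ
  goodInside Y = countB inL (mTsubsets Y)

  mTsubsets-length : (Y : Subset N) → length (mTsubsets Y) ≡ ∣ Y ∣ C mT
  mTsubsets-length Y = trans (length-filterᵇ _ (allSubsets N)) (subsetsOfSize Y mT)

  β-formula : (Y : Subset N) → β Y ≡ weight (∣ Y ∣ C mT) * toℚ (goodInside Y)
  β-formula Y = trans (Pr-uniform (mTsubsets Y) inL) (cong (λ m → weight m * toℚ (goodInside Y)) (mTsubsets-length Y))

  goodInside≤ : (Y : Subset N) → goodInside Y ≤ ∣ Y ∣ C mT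
  goodInside≤ Y = subst (goodInside Y ≤_) (mTsubsets-length Y) (countB≤length inL (mTsubsets Y))

  LT-inside : (Y : Subset N) → countB (λ J → does (J ⊆? Y)) LT ≡ goodInside Y
  LT-inside Y = begin
    countB (λ J → does (J ⊆? Y)) LT
      ≡⟨ countB-filterᵇ _ _ (allSubsets N) ⟩
    countB (λ J → ((∣ J ∣ ≡ᵇ mT) ∧ inL J) ∧ does (J ⊆? Y)) (allSubsets N)
      ≡⟨ countB-cong (allSubsets N) (λ J → ∧-swapʳ (∣ J ∣ ≡ᵇ mT) (inL J) (does (J ⊆? Y))) ⟩
    countB (λ J → ((∣ J ∣ ≡ᵇ mT) ∧ does (J ⊆? Y)) ∧ inL J) (allSubsets N)
      ≡⟨ sym (countB-filterᵇ inL _ (allSubsets N)) ⟩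
    goodInside Y ∎
    where open ≡-Reasoning

  -- The contribution to P(A_{k+1} = A, 𝐇_k = H) of each member of ℒ_T inside H - A.
  stepWeight : Fin T → ℚ
  stepWeight k = weight (length LT) * (weight (arrangements (N ∸ mT) T) * toℚ (markedArrangements (N ∸ mT) (toℕ k) T))

  stepProbability : (k : Fin T) (A : Fin N) (H : Subset N) → ∣ H ∣ ≡ N ∸ toℕ k → lookup H A ≡ true →
    Pr Ω (Step k A H) ≡ stepWeight k * toℚ (goodInside (H - A))
  stepProbability k A H ∣H∣ HA = begin
    Pr Ω (Step k A H)
      ≡⟨ Pr-twoStage LT orderings (Step k A H) ⟩
    w * sumQ (λ J → weight (length (orderings J)) * toℚ (countB (λ σ → Step k A H (J , σ)) (orderings J))) LT
      ≡⟨ cong (w *_) (sumQ-on-filter _ (allSubsets N) perMember) ⟩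
    w * sumQ (λ J → if does (J ⊆? (H - A)) then c else 0ℚ) LT
      ≡⟨ cong (w *_) (sumQ-indicator c (λ J → does (J ⊆? (H - A))) LT) ⟩
    w * (c * toℚ (countB (λ J → does (J ⊆? (H - A))) LT))
      ≡⟨ cong (λ z → w * (c * toℚ z)) (LT-inside (H - A)) ⟩
    w * (c * toℚ (goodInside (H - A)))
      ≡⟨ sym (ℚₚ.*-assoc w c _) ⟩
    stepWeight k * toℚ (goodInside (H - A)) ∎
    where
    open ≡-Reasoning
    w c : ℚ
    w = weight (length LT)
    c = weight (arrangements (N ∸ mT) T) * toℚ (markedArrangements (N ∸ mT) (toℕ k) T)
    weighted : ∀ b → weight (arrangements (N ∸ mT) T) * toℚ (if b then markedArrangements (N ∸ mT) (toℕ k) T else 0)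
                     ≡ (if b then c else 0ℚ)
    weighted true  = refl
    weighted false = ℚₚ.*-zeroʳ (weight (arrangements (N ∸ mT) T))
    perMember : ∀ J → ((∣ J ∣ ≡ᵇ mT) ∧ inL J) ≡ true →
      weight (length (orderings J)) * toℚ (countB (λ σ → Step k A H (J , σ)) (orderings J))
        ≡ (if does (J ⊆? (H - A)) then c else 0ℚ)
    perMember J J∈LT = trans
      (cong₂ (λ ℓ m → weight ℓ * toℚ m) (orderings-length J ∣J∣) (orderings-step J H k A ∣J∣ ∣H∣ HA))
      (weighted (does (J ⊆? (H - A))))
      where
      ∣J∣ : ∣ J ∣ ≡ mT
      ∣J∣ = to ≡ᵇ⇔ (∧-conicalˡ _ _ J∈LT)

open import Data.Rational using (_<_; _*_; 1/_; NonZero; ≢-nonZero)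
import Data.Rational.Properties as ℚₚ
open import Algebra.Bundles using (CommutativeMonoid)
open import Algebra.Properties.CommutativeSemigroup
  (CommutativeMonoid.commutativeSemigroup ℚₚ.*-1-commutativeMonoid) using (xy∙z≈xz∙y)
open Finite using (size-removal)
open Probability using (toℚ; weight; proportional; CondPr-unfold)

mainTheorem5 : (r n : ℕ) → 3 ≤ r → r ∣ n → (δ : Fin n → ℤ) → (mT : ℕ) →
    let open Setup n r δ mT in
    mT ≤ N →
    (∃ λ (J : Subset N) → inL J ≡ true × ∣ J ∣ ≡ mT) →
    (k : Fin T) → (H : Subset N) → ∣ H ∣ ≡ N ∸ toℕ k →
    0ℚ < Pr Ω (λ ω → subsetEq (H-at (toℕ k) ω) H) →
    ∃ λ (c : ℚ) → (A : Fin N) → A ∈ H →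
      CondPr Ω (λ ω → finEq (A-at k ω) A) (λ ω → subsetEq (H-at (toℕ k) ω) H)
        ≡ c * β (H - A)
mainTheorem5 r n _ _ δ mT _ _ k H ∣H∣ 0<PF = c′ * 1/ PF , conditional
  where
  open Setup n r δ mT
  open Model n r δ mT
  F : Subset N × Vec (Fin N) T → Bool
  F ω = subsetEq (H-at (toℕ k) ω) H
  PF : ℚ
  PF = Pr Ω F
  PF≢0 : PF ≢ 0ℚ
  PF≢0 = ≢-sym (ℚₚ.<⇒≢ 0<PF)
  instance
    PF-nonZero : NonZero PF
    PF-nonZero = ≢-nonZero PF≢0
  -- the common number of m_T-subsets of the sets H - A with A ∈ H
  M : ℕ
  M = pred ∣ H ∣ C mT
  c′ : ℚ
  c′ = proj₁ (proportional (stepWeight k) M)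
  conditional : (A : Fin N) → A ∈ H → CondPr Ω (λ ω → finEq (A-at k ω) A) F ≡ (c′ * 1/ PF) * β (H - A)
  conditional A A∈H = begin
    CondPr Ω (λ ω → finEq (A-at k ω) A) F                    ≡⟨ CondPr-unfold Ω _ F PF≢0 ⟩
    Pr Ω (Step k A H) * 1/ PF                                ≡⟨ cong (_* 1/ PF) (stepProbability k A H ∣H∣ HA) ⟩
    (stepWeight k * toℚ z) * 1/ PF                           ≡⟨ cong (_* 1/ PF) (proj₂ (proportional (stepWeight k) M) z z≤M) ⟩
    (c′ * (weight M * toℚ z)) * 1/ PF                        ≡⟨ cong (λ m → (c′ * (weight (m C mT) * toℚ z)) * 1/ PF) (sym ∣H-A∣) ⟩
    (c′ * (weight (∣ H - A ∣ C mT) * toℚ z)) * 1/ PF         ≡⟨ cong (λ b → (c′ * b) * 1/ PF) (sym (β-formula (H - A))) ⟩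
    (c′ * β (H - A)) * 1/ PF                                 ≡⟨ xy∙z≈xz∙y c′ (β (H - A)) (1/ PF) ⟩
    (c′ * 1/ PF) * β (H - A)                                 ∎
    where
    open ≡-Reasoning
    HA : lookup H A ≡ true
    HA = Vecₚ.[]=⇒lookup A∈H
    ∣H-A∣ : ∣ H - A ∣ ≡ pred ∣ H ∣
    ∣H-A∣ = size-removal H A HA
    z : ℕ
    z = goodInside (H - A)
    z≤M : z ≤ M
    z≤M = subst (λ m → z ≤ m C mT) ∣H-A∣ (goodInside≤ (H - A))
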